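{- For all integers $k\ge0$, $l\ge1$, $m\ge0$, the Wiener index of the onion graph $\mathrm{On}(k,l,m)$ equals $$k^2+7k+8+\frac{l^3-l}{6}+m^2+m\,\frac{l^2+l-2}{2}+(k+3)\Big(\frac{l^2-l}{2}+ml\Big)+(l+m-1)(3k+4).$$
   Context: The Wiener index of a connected graph $G$ is $W(G)=\sum_{\{u,v\}\subseteq V(G)}\mathrm{dist}_G(u,v)$, summed over unordered pairs of distinct vertices. For integers $k\ge 0$, $l\ge 1$, $m\ge 0$, the onion graph $\mathrm{On}(k,l,m)$ is formed by a cycle of length four with antipodal (non-adjacent) vertices $u,v$, together with $k$ pendant edges attached to $v$, a path $P_l$ on $l$ vertices one of whose endpoints is identified with $u$, and $m$ pendant edges attached to the other endpoint of $P_l$ (when $l=1$ the endpoints coincide). -}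

module Defs where

open import Data.Nat using (ℕ; zero; suc; _+_; _*_; _∸_; _<ᵇ_; _≡ᵇ_)
open import Data.Bool using (Bool; true; false; _∧_; _∨_; if_then_else_)
open import Data.Fin using (Fin; toℕ)
open import Data.Bool.ListAction using (any)
open import Data.Nat.ListAction using (sum)
open import Data.List using (List; []; _∷_; map; concatMap; filter; upTo)
open import Data.List using (allFin) public
open import Data.Product using (_×_; _,_)

Graph : ℕ → Set
Graph n = Fin n → Fin n → Bool

fromEdges : (n : ℕ) → List (ℕ × ℕ) → Graph n
fromEdges n es x y = any (λ { (a , b) → ((a ≡ᵇ toℕ x) ∧ (b ≡ᵇ toℕ y)) ∨ ((a ≡ᵇ toℕ y) ∧ (b ≡ᵇ toℕ x)) }) es

within : ∀ {n} → Graph n → ℕ → Fin n → Fin n → Bool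
within G zero    u v = toℕ u ≡ᵇ toℕ v
within G (suc d) u v = within G d u v ∨ any (λ w → within G d u w ∧ G w v) (allFin _)

search : ∀ {n} → Graph n → Fin n → Fin n → ℕ → ℕ → ℕ
search G u v i zero       = i
search G u v i (suc fuel) = if within G i u v then i else search G u v (suc i) fuel

-- Graph distance: length of a shortest u–v walk (= shortest path).
-- In a connected graph on n vertices this is always < n, so searching
-- d = 0 .. n-1 finds it.
dist : ∀ {n} → Graph n → Fin n → Fin n → ℕ
dist {n} G u v = search G u v 0 n

wiener : ∀ {n} → Graph n → ℕ
wiener {n} G =
  sum (concatMap (λ u → map (λ v → dist G u v)
                             (filter (λ v → Data.Nat._<?_ (toℕ u) (toℕ v)) (allFin n)))
                 (allFin n))

-- The onion graph On(k,l,m), with n = 3 + k + l + m vertices labelled: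
--   0 = a, 1 = v, 2 = b           (the 4-cycle is  u – a – v – b – u)
--   3 .. 3+k-1                    the k pendant vertices at v
--   3+k .. 3+k+l-1                the path P_l = p₁ … p_l, with p₁ = u
--   3+k+l .. 3+k+l+m-1            the m pendant vertices at p_l

onionEdges : ℕ → ℕ → ℕ → List (ℕ × ℕ)
onionEdges k l m =
  (U , 0) ∷ (0 , 1) ∷ (1 , 2) ∷ (2 , U) ∷
  (map (λ i → (1 , 3 + i)) (upTo k)
   Data.List.++ map (λ i → (U + i , U + suc i)) (upTo (l ∸ 1))
   Data.List.++ map (λ j → (U + (l ∸ 1) , U + l + j)) (upTo m))
  where U = 3 + k

onionSize : ℕ → ℕ → ℕ → ℕ
onionSize k l m = 3 + k + l + m

On : (k l m : ℕ) → Graph (onionSize k l m)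
On k l m = fromEdges (onionSize k l m) (onionEdges k l m)

module Submission where

-- Put the vertices of On(k,l,m) into layers: the k pendants at v form layer 0, v layer 1,
-- the two other cycle vertices layer 2, the j-th path vertex layer 2 + j and the m pendants
-- at the end of the path layer 3 + l.  Two vertices are adjacent exactly when their layers
-- differ by one, and the occupied layers form an interval.  In such a graph the distance
-- between distinct vertices is the difference of their layers, or 2 inside a layer: every
-- step changes the layer by one, and from any vertex one can step one layer closer to the
-- target (or, inside a layer, out to a neighbouring layer and back).  Summing these
-- distances vertex by vertex against all earlier vertices gives arithmetic sums of linear
-- and triangular numbers, whose closed forms make up the stated polynomial.

open import Defs
open import Data.Bool using (true; false; T; if_then_else_; _∧_; _∨_)
open import Data.Bool.Properties using (T-∨; T-∧)
open import Data.Fin as Fin using (Fin; toℕ; fromℕ<)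
open import Data.Fin.Properties using (toℕ<n; toℕ-fromℕ<)
open import Data.List using (List; []; _∷_; map; concat; filter; tabulate; upTo)
open import Data.List.Membership.Propositional using (lose)
open import Data.List.Membership.Propositional.Properties using (∈-allFin; ∈-upTo⁺)
open import Data.List.Properties using (map-cong; map-∘; map-tabulate)
open import Data.List.Relation.Unary.All as All using (All; _∷_)
import Data.List.Relation.Unary.All.Properties as All
open import Data.List.Relation.Unary.Any as Any using (Any; here; there; satisfied)
import Data.List.Relation.Unary.Any.Properties as Any
open import Data.Nat
  using (ℕ; zero; suc; _+_; _*_; _∸_; _^_; _/_; _≤_; _<_; z≤n; s≤s; s≤s⁻¹; _≡ᵇ_; _⊓_; ∣_-_∣; NonZero)
open import Data.Nat.DivMod using (m*n/n≡m)
open import Data.Nat.ListAction using (sum)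
open import Data.Nat.ListAction.Properties using (sum-++)
open import Data.Nat.Properties
open import Data.Nat.Tactic.RingSolver using (solve-∀)
open import Data.Product using (_×_; _,_; Σ-syntax)
open import Data.Sum using (_⊎_; inj₁; inj₂)
open import Data.Unit using (tt)
open import Function using (_∘_; id)
open import Function.Bundles using (Equivalence)
open import Relation.Binary.Definitions using (tri<; tri≈; tri>)
open import Relation.Binary.PropositionalEquality
open import Relation.Nullary using (Dec; yes; no; does; contradiction)
open import Relation.Nullary.Decidable using (dec-true; dec-false)
open Equivalence using (to; from)
open ≡-Reasoning

sumBelow : ℕ → (ℕ → ℕ) → ℕ
sumBelow zero    f = 0
sumBelow (suc n) f = f 0 + sumBelow n (f ∘ suc)

sumBelow-cong : ∀ n {f g : ℕ → ℕ} → (∀ i → i < n → f i ≡ g i) → sumBelow n f ≡ sumBelow n g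
sumBelow-cong zero    f≡g = refl
sumBelow-cong (suc n) f≡g = cong₂ _+_ (f≡g 0 (s≤s z≤n)) (sumBelow-cong n (λ i i<n → f≡g (suc i) (s≤s i<n)))

sumBelow-+ : ∀ m n f → sumBelow (m + n) f ≡ sumBelow m f + sumBelow n (f ∘ (m +_))
sumBelow-+ zero    n f = refl
sumBelow-+ (suc m) n f = trans (cong (f 0 +_) (sumBelow-+ m n (f ∘ suc))) (sym (+-assoc (f 0) _ _))

sumBelow-suc : ∀ n f → sumBelow (suc n) f ≡ sumBelow n f + f n
sumBelow-suc zero    f = +-comm (f 0) 0
sumBelow-suc (suc n) f = trans (cong (f 0 +_) (sumBelow-suc n (f ∘ suc))) (sym (+-assoc (f 0) _ _))

sumBelow-const : ∀ n c → sumBelow n (λ _ → c) ≡ n * c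
sumBelow-const zero    c = refl
sumBelow-const (suc n) c = cong (c +_) (sumBelow-const n c)

sumBelow-distrib : ∀ n f g → sumBelow n (λ i → f i + g i) ≡ sumBelow n f + sumBelow n g
sumBelow-distrib zero    f g = refl
sumBelow-distrib (suc n) f g = begin
  f 0 + g 0 + sumBelow n (λ i → f (suc i) + g (suc i))
    ≡⟨ cong (f 0 + g 0 +_) (sumBelow-distrib n (f ∘ suc) (g ∘ suc)) ⟩
  f 0 + g 0 + (sumBelow n (f ∘ suc) + sumBelow n (g ∘ suc))
    ≡⟨ +-interchange (f 0) (g 0) _ _ ⟩
  f 0 + sumBelow n (f ∘ suc) + (g 0 + sumBelow n (g ∘ suc)) ∎
  where
  +-interchange : ∀ a b c d → a + b + (c + d) ≡ a + c + (b + d)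
  +-interchange = solve-∀

sumBelow-*ˡ : ∀ n c f → sumBelow n (λ i → c * f i) ≡ c * sumBelow n f
sumBelow-*ˡ zero    c f = sym (*-zeroʳ c)
sumBelow-*ˡ (suc n) c f =
  trans (cong (c * f 0 +_) (sumBelow-*ˡ n c (f ∘ suc))) (sym (*-distribˡ-+ c (f 0) _))

sumBelow-swap : ∀ m n (f : ℕ → ℕ → ℕ) →
  sumBelow m (λ i → sumBelow n (f i)) ≡ sumBelow n (λ j → sumBelow m (λ i → f i j))
sumBelow-swap zero    n f = sym (trans (sumBelow-const n 0) (*-zeroʳ n))
sumBelow-swap (suc m) n f = begin
  sumBelow n (f 0) + sumBelow m (λ i → sumBelow n (f (suc i)))
    ≡⟨ cong (sumBelow n (f 0) +_) (sumBelow-swap m n (f ∘ suc)) ⟩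
  sumBelow n (f 0) + sumBelow n (λ j → sumBelow m (λ i → f (suc i) j))
    ≡⟨ sym (sumBelow-distrib n (f 0) _) ⟩
  sumBelow n (λ j → sumBelow (suc m) (λ i → f i j)) ∎

sumBelow-below : ∀ n v (g : ℕ → ℕ) → v ≤ n →
  sumBelow n (λ u → if does (u <? v) then g u else 0) ≡ sumBelow v g
sumBelow-below n v g v≤n = begin
  sumBelow n h                                  ≡⟨ cong (λ n → sumBelow n h) (sym (m+[n∸m]≡n v≤n)) ⟩
  sumBelow (v + (n ∸ v)) h                      ≡⟨ sumBelow-+ v (n ∸ v) h ⟩
  sumBelow v h + sumBelow (n ∸ v) (h ∘ (v +_))  ≡⟨ cong₂ _+_ (sumBelow-cong v below) (sumBelow-cong (n ∸ v) above) ⟩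
  sumBelow v g + sumBelow (n ∸ v) (λ _ → 0)     ≡⟨ cong (sumBelow v g +_) (sumBelow-const (n ∸ v) 0) ⟩
  sumBelow v g + (n ∸ v) * 0                    ≡⟨ cong (sumBelow v g +_) (*-zeroʳ (n ∸ v)) ⟩
  sumBelow v g + 0                              ≡⟨ +-identityʳ _ ⟩
  sumBelow v g ∎
  where
  h : ℕ → ℕ
  h u = if does (u <? v) then g u else 0
  below : ∀ u → u < v → h u ≡ g u
  below u u<v rewrite dec-true (u <? v) u<v = refl
  above : ∀ i → i < n ∸ v → h (v + i) ≡ 0
  above i _ rewrite dec-false (v + i <? v) (≤⇒≯ (m≤m+n v i)) = refl

triangular : ℕ → ℕ
triangular n = sumBelow n id

tetrahedral : ℕ → ℕ
tetrahedral n = sumBelow n triangular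

square≡triangular : ∀ n → n ^ 2 ≡ triangular n * 2 + n
square≡triangular zero    = refl
square≡triangular (suc n) = sym (begin
  triangular (suc n) * 2 + suc n  ≡⟨ cong (λ t → t * 2 + suc n) (sumBelow-suc n id) ⟩
  (triangular n + n) * 2 + suc n  ≡⟨ regroup n (triangular n) ⟩
  triangular n * 2 + n + 2 * n + 1 ≡⟨ cong (λ s → s + 2 * n + 1) (sym (square≡triangular n)) ⟩
  n ^ 2 + 2 * n + 1               ≡⟨ expand n ⟩
  suc n ^ 2 ∎)
  where
  -- The ring solver does not see through _^_, so the powers are written out.
  regroup : ∀ n t → (t + n) * 2 + suc n ≡ t * 2 + n + 2 * n + 1
  regroup = solve-∀
  expand : ∀ n → n * (n * 1) + 2 * n + 1 ≡ suc n * (suc n * 1)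
  expand = solve-∀

cube≡tetrahedral : ∀ n → n ^ 3 ≡ (tetrahedral n + triangular n) * 6 + n
cube≡tetrahedral zero    = refl
cube≡tetrahedral (suc n) = sym (begin
  (tetrahedral (suc n) + triangular (suc n)) * 6 + suc n
    ≡⟨ cong₂ (λ T t → (T + t) * 6 + suc n) (sumBelow-suc n triangular) (sumBelow-suc n id) ⟩
  (tetrahedral n + triangular n + (triangular n + n)) * 6 + suc n
    ≡⟨ regroup n (tetrahedral n) (triangular n) ⟩
  ((tetrahedral n + triangular n) * 6 + n) + 3 * (triangular n * 2 + n) + 3 * n + 1
    ≡⟨ cong₂ (λ c s → c + 3 * s + 3 * n + 1) (sym (cube≡tetrahedral n)) (sym (square≡triangular n)) ⟩
  n ^ 3 + 3 * n ^ 2 + 3 * n + 1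
    ≡⟨ expand n ⟩
  suc n ^ 3 ∎)
  where
  regroup : ∀ n T t → (T + t + (t + n)) * 6 + suc n ≡ ((T + t) * 6 + n) + 3 * (t * 2 + n) + 3 * n + 1
  regroup = solve-∀
  expand : ∀ n → n * (n * (n * 1)) + 3 * (n * (n * 1)) + 3 * n + 1 ≡ suc n * (suc n * (suc n * 1))
  expand = solve-∀

sumBelow-linear : ∀ n a b → sumBelow n (λ i → a + b * i) ≡ n * a + b * triangular n
sumBelow-linear n a b =
  trans (sumBelow-distrib n (λ _ → a) (b *_)) (cong₂ _+_ (sumBelow-const n a) (sumBelow-*ˡ n b id))

sumBelow-linear+triangular : ∀ n a b →
  sumBelow n (λ i → a + b * i + triangular i) ≡ n * a + b * triangular n + tetrahedral n
sumBelow-linear+triangular n a b =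
  trans (sumBelow-distrib n (λ i → a + b * i) triangular) (cong (_+ tetrahedral n) (sumBelow-linear n a b))

sumBelow-∸ : ∀ j → sumBelow j (j ∸_) ≡ triangular j + j
sumBelow-∸ zero    = refl
sumBelow-∸ (suc j) = begin
  suc j + sumBelow j (j ∸_)    ≡⟨ cong (suc j +_) (sumBelow-∸ j) ⟩
  suc j + (triangular j + j)   ≡⟨ regroup j (triangular j) ⟩
  triangular j + j + suc j     ≡⟨ cong (_+ suc j) (sym (sumBelow-suc j id)) ⟩
  triangular (suc j) + suc j ∎
  where
  regroup : ∀ j t → suc j + (t + j) ≡ t + j + suc j
  regroup = solve-∀

exact-quotient : ∀ {x} q d o .{{_ : NonZero d}} → x ≡ q * d + o → (x ∸ o) / d ≡ q
exact-quotient q d o refl = trans (cong (_/ d) (m+n∸n≡m (q * d) o)) (m*n/n≡m q d)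

cube-quotient : ∀ n → (n ^ 3 ∸ n) / 6 ≡ tetrahedral n + triangular n
cube-quotient n = exact-quotient _ 6 n (cube≡tetrahedral n)

square-quotient : ∀ n → (n ^ 2 ∸ n) / 2 ≡ triangular n
square-quotient n = exact-quotient _ 2 n (square≡triangular n)

square+-quotient : ∀ n → (suc n ^ 2 + suc n ∸ 2) / 2 ≡ triangular (suc n) + n
square+-quotient n = exact-quotient _ 2 2
  (trans (cong (_+ suc n) (square≡triangular (suc n))) (regroup n (triangular (suc n))))
  where
  regroup : ∀ n t → t * 2 + suc n + suc n ≡ (t + n) * 2 + 2
  regroup = solve-∀

sum-concat : ∀ xss → sum (concat xss) ≡ sum (map sum xss)
sum-concat []         = refl
sum-concat (xs ∷ xss) = trans (sum-++ xs (concat xss)) (cong (sum xs +_) (sum-concat xss))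

sum-map-filter : ∀ {A : Set} {P : A → Set} (P? : ∀ x → Dec (P x)) (F : A → ℕ) xs →
  sum (map F (filter P? xs)) ≡ sum (map (λ x → if does (P? x) then F x else 0) xs)
sum-map-filter P? F []       = refl
sum-map-filter P? F (x ∷ xs) with does (P? x)
... | true  = cong (F x +_) (sum-map-filter P? F xs)
... | false = sum-map-filter P? F xs

sum-map-allFin : ∀ n (g : ℕ → ℕ) → sum (map (g ∘ toℕ) (allFin n)) ≡ sumBelow n g
sum-map-allFin zero    g = refl
sum-map-allFin (suc n) g = cong (g 0 +_) (begin
  sum (map (g ∘ toℕ) (tabulate {n = n} Fin.suc))  ≡⟨ cong sum (map-tabulate {n = n} Fin.suc (g ∘ toℕ)) ⟩
  sum (tabulate {n = n} (g ∘ suc ∘ toℕ))          ≡⟨ cong sum (sym (map-tabulate {n = n} id (g ∘ suc ∘ toℕ))) ⟩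
  sum (map (g ∘ suc ∘ toℕ) (allFin n))    ≡⟨ sum-map-allFin n (g ∘ suc) ⟩
  sumBelow n (g ∘ suc) ∎)

wiener≡sumBelow : ∀ {n} (G : Graph n) (d : ℕ → ℕ → ℕ) → (∀ x y → dist G x y ≡ d (toℕ x) (toℕ y)) →
  wiener G ≡ sumBelow n (λ v → sumBelow v (λ u → d u v))
wiener≡sumBelow {n} G d dist≡d = begin
  wiener G
    ≡⟨ sum-concat (map row (allFin n)) ⟩
  sum (map sum (map row (allFin n)))
    ≡⟨ cong sum (sym (map-∘ (allFin n))) ⟩
  sum (map (sum ∘ row) (allFin n))
    ≡⟨ cong sum (map-cong row-sum (allFin n)) ⟩
  sum (map ((λ u → sumBelow n (later u)) ∘ toℕ) (allFin n))
    ≡⟨ sum-map-allFin n (λ u → sumBelow n (later u)) ⟩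
  sumBelow n (λ u → sumBelow n (later u))
    ≡⟨ sumBelow-swap n n later ⟩
  sumBelow n (λ v → sumBelow n (λ u → later u v))
    ≡⟨ sumBelow-cong n (λ v v<n → sumBelow-below n v (λ u → d u v) (<⇒≤ v<n)) ⟩
  sumBelow n (λ v → sumBelow v (λ u → d u v)) ∎
  where
  row : Fin n → List ℕ
  row u = map (dist G u) (filter (λ v → toℕ u <? toℕ v) (allFin n))
  later : ℕ → ℕ → ℕ
  later u v = if does (u <? v) then d u v else 0
  row-sum : ∀ u → sum (row u) ≡ sumBelow n (later (toℕ u))
  row-sum u = begin
    sum (row u)
      ≡⟨ sum-map-filter (λ v → toℕ u <? toℕ v) (dist G u) (allFin n) ⟩
    sum (map (λ v → if does (toℕ u <? toℕ v) then dist G u v else 0) (allFin n))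
      ≡⟨ cong sum (map-cong (λ v → cong (λ e → if does (toℕ u <? toℕ v) then e else 0) (dist≡d u v)) (allFin n)) ⟩
    sum (map (later (toℕ u) ∘ toℕ) (allFin n))
      ≡⟨ sum-map-allFin n (later (toℕ u)) ⟩
    sumBelow n (later (toℕ u)) ∎

Consecutive : ℕ → ℕ → Set
Consecutive a b = suc a ≡ b ⊎ suc b ≡ a

consecutive-sym : ∀ {a b} → Consecutive a b → Consecutive b a
consecutive-sym (inj₁ e) = inj₂ e
consecutive-sym (inj₂ e) = inj₁ e

consecutive⇒∣-∣≡1 : ∀ {a b} → Consecutive a b → ∣ a - b ∣ ≡ 1
consecutive⇒∣-∣≡1 {a} (inj₁ refl) = trans (m≤n⇒∣m-n∣≡n∸m (n≤1+n a)) (m+n∸n≡m 1 a)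
consecutive⇒∣-∣≡1 {b = b} (inj₂ refl) = trans (m≤n⇒∣n-m∣≡n∸m (n≤1+n b)) (m+n∸n≡m 1 b)

consecutive⇒≢ : ∀ {a b} → Consecutive a b → a ≢ b
consecutive⇒≢ (inj₁ e) refl = 1+n≢n e
consecutive⇒≢ (inj₂ e) refl = 1+n≢n e

Between : ℕ → ℕ → ℕ → Set
Between a b r = (a ≤ r × r ≤ b) ⊎ (b ≤ r × r ≤ a)

StepToward : ℕ → ℕ → Set
StepToward a b = Σ[ r ∈ ℕ ] Consecutive r b × Between a b r × suc ∣ a - r ∣ ≡ ∣ a - b ∣

stepDown : ∀ {a b} → a < b → StepToward a b
stepDown {a} {suc r} (s≤s a≤r) = r , inj₁ refl , inj₁ (a≤r , n≤1+n r) , (begin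
  suc ∣ a - r ∣  ≡⟨ cong suc (m≤n⇒∣m-n∣≡n∸m a≤r) ⟩
  suc (r ∸ a)    ≡⟨ sym (+-∸-assoc 1 a≤r) ⟩
  suc r ∸ a      ≡⟨ sym (m≤n⇒∣m-n∣≡n∸m (m≤n⇒m≤1+n a≤r)) ⟩
  ∣ a - suc r ∣ ∎)

stepUp : ∀ {a b} → b < a → StepToward a b
stepUp {a} {b} b<a = suc b , inj₂ refl , inj₂ (n≤1+n b , b<a) , (begin
  suc ∣ a - suc b ∣  ≡⟨ cong suc (m≤n⇒∣n-m∣≡n∸m b<a) ⟩
  suc (a ∸ suc b)    ≡⟨ sym (+-∸-assoc 1 b<a) ⟩
  a ∸ b              ≡⟨ sym (m≤n⇒∣n-m∣≡n∸m (<⇒≤ b<a)) ⟩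
  ∣ a - b ∣ ∎)

stepToward : ∀ {a b} → a ≢ b → StepToward a b
stepToward {a} {b} a≢b with <-cmp a b
... | tri< a<b _ _ = stepDown a<b
... | tri≈ _ a≡b _ = contradiction a≡b a≢b
... | tri> _ _ b<a = stepUp b<a

layerDist : (ℕ → ℕ) → ℕ → ℕ → ℕ
layerDist ℓ X Y with X ≟ Y | ℓ X ≟ ℓ Y
... | yes _ | _     = 0
... | no _  | yes _ = 2
... | no _  | no _  = ∣ ℓ X - ℓ Y ∣

module _ (ℓ : ℕ → ℕ) where

  layerDist-refl : ∀ X → layerDist ℓ X X ≡ 0
  layerDist-refl X with X ≟ X
  ... | yes _   = refl
  ... | no X≢X  = contradiction refl X≢X

  layerDist-sameLayer : ∀ {X Y} → X ≢ Y → ℓ X ≡ ℓ Y → layerDist ℓ X Y ≡ 2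
  layerDist-sameLayer {X} {Y} X≢Y ℓX≡ℓY with X ≟ Y | ℓ X ≟ ℓ Y
  ... | yes X≡Y | _           = contradiction X≡Y X≢Y
  ... | no _    | yes _       = refl
  ... | no _    | no ℓX≢ℓY    = contradiction ℓX≡ℓY ℓX≢ℓY

  layerDist-otherLayer : ∀ {X Y} → ℓ X ≢ ℓ Y → layerDist ℓ X Y ≡ ∣ ℓ X - ℓ Y ∣
  layerDist-otherLayer {X} {Y} ℓX≢ℓY with X ≟ Y | ℓ X ≟ ℓ Y
  ... | yes refl | _         = contradiction refl ℓX≢ℓY
  ... | no _     | yes ℓX≡ℓY = contradiction ℓX≡ℓY ℓX≢ℓY
  ... | no _     | no _      = refl

  layerDist≡0⇒≡ : ∀ {X Y} → layerDist ℓ X Y ≡ 0 → X ≡ Y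
  layerDist≡0⇒≡ {X} {Y} d≡0 with X ≟ Y | ℓ X ≟ ℓ Y
  layerDist≡0⇒≡ _   | yes X≡Y | _         = X≡Y
  layerDist≡0⇒≡ ()  | no _    | yes _
  layerDist≡0⇒≡ d≡0 | no _    | no ℓX≢ℓY  = contradiction (∣m-n∣≡0⇒m≡n d≡0) ℓX≢ℓY

  ∣-∣≤layerDist : ∀ X Y → ∣ ℓ X - ℓ Y ∣ ≤ layerDist ℓ X Y
  ∣-∣≤layerDist X Y with X ≟ Y | ℓ X ≟ ℓ Y
  ... | yes refl | _          = ≤-reflexive (∣n-n∣≡0 (ℓ X))
  ... | no _     | yes ℓX≡ℓY  rewrite ℓX≡ℓY | ∣n-n∣≡0 (ℓ Y) = z≤n
  ... | no _     | no _       = ≤-refl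

  layerDist≤ : ∀ {X Y c} → ℓ X ≤ c → ℓ Y ≤ c → 2 ≤ c → layerDist ℓ X Y ≤ c
  layerDist≤ {X} {Y} ℓX≤c ℓY≤c 2≤c with X ≟ Y | ℓ X ≟ ℓ Y
  ... | yes _ | _     = z≤n
  ... | no _  | yes _ = 2≤c
  ... | no _  | no _  = ≤-trans (∣m-n∣≤m⊔n (ℓ X) (ℓ Y)) (⊔-lub ℓX≤c ℓY≤c)

module LayeredGraph {n : ℕ} (G : Graph n) (ℓ : ℕ → ℕ)
  (edge⇒consecutive : ∀ (x y : Fin n) → T (G x y) → Consecutive (ℓ (toℕ x)) (ℓ (toℕ y)))
  (consecutive⇒edge : ∀ (x y : Fin n) → Consecutive (ℓ (toℕ x)) (ℓ (toℕ y)) → T (G x y))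
  (convex : ∀ (x y : Fin n) (r : ℕ) → ℓ (toℕ x) ≤ r → r ≤ ℓ (toℕ y) → Σ[ w ∈ Fin n ] ℓ (toℕ w) ≡ r)
  (x₀ x₁ : Fin n) (ℓx₀≢ℓx₁ : ℓ (toℕ x₀) ≢ ℓ (toℕ x₁))
  where

  D : Fin n → Fin n → ℕ
  D x y = layerDist ℓ (toℕ x) (toℕ y)

  layerDist-step : ∀ x w y → Consecutive (ℓ (toℕ w)) (ℓ (toℕ y)) → D x y ≤ suc (D x w)
  layerDist-step x w y c with toℕ x ≟ toℕ y | ℓ (toℕ x) ≟ ℓ (toℕ y)
  ... | yes _ | _ = z≤n
  ... | no _ | yes ℓx≡ℓy
    rewrite layerDist-otherLayer ℓ (λ ℓx≡ℓw → consecutive⇒≢ c (trans (sym ℓx≡ℓw) ℓx≡ℓy))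
          | ℓx≡ℓy | ∣-∣-comm (ℓ (toℕ y)) (ℓ (toℕ w)) | consecutive⇒∣-∣≡1 c = ≤-refl
  ... | no _ | no _ = ≤-trans (∣-∣-triangle (ℓ (toℕ x)) (ℓ (toℕ w)) (ℓ (toℕ y)))
    (≤-trans (+-mono-≤ (∣-∣≤layerDist ℓ (toℕ x) (toℕ w)) (≤-reflexive (consecutive⇒∣-∣≡1 c)))
             (≤-reflexive (+-comm (D x w) 1)))

  layerBetween : ∀ x y r → Between (ℓ (toℕ x)) (ℓ (toℕ y)) r → Σ[ w ∈ Fin n ] ℓ (toℕ w) ≡ r
  layerBetween x y r (inj₁ (ℓx≤r , r≤ℓy)) = convex x y r ℓx≤r r≤ℓy
  layerBetween x y r (inj₂ (ℓy≤r , r≤ℓx)) = convex y x r ℓy≤r r≤ℓx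

  neighbourTowards : ∀ z y → ℓ (toℕ z) ≢ ℓ (toℕ y) → Σ[ w ∈ Fin n ] Consecutive (ℓ (toℕ w)) (ℓ (toℕ y))
  neighbourTowards z y ℓz≢ℓy with r , c , btw , _ ← stepToward ℓz≢ℓy with w , refl ← layerBetween z y r btw = w , c

  neighbour : ∀ y → Σ[ w ∈ Fin n ] Consecutive (ℓ (toℕ w)) (ℓ (toℕ y))
  neighbour y with ℓ (toℕ x₀) ≟ ℓ (toℕ y)
  ... | yes ℓx₀≡ℓy = neighbourTowards x₁ y (λ ℓx₁≡ℓy → ℓx₀≢ℓx₁ (trans ℓx₀≡ℓy (sym ℓx₁≡ℓy)))
  ... | no ℓx₀≢ℓy  = neighbourTowards x₀ y ℓx₀≢ℓy

  Predecessor : Fin n → Fin n → Set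
  Predecessor x y = Σ[ w ∈ Fin n ] T (G w y) × suc (D x w) ≡ D x y

  predecessor-sameLayer : ∀ x y → toℕ x ≢ toℕ y → ℓ (toℕ x) ≡ ℓ (toℕ y) → Predecessor x y
  predecessor-sameLayer x y x≢y ℓx≡ℓy with w , c ← neighbour y = w , consecutive⇒edge w y c , (begin
    suc (D x w)                    ≡⟨ cong suc (layerDist-otherLayer ℓ ℓx≢ℓw) ⟩
    suc ∣ ℓ (toℕ x) - ℓ (toℕ w) ∣  ≡⟨ cong (λ a → suc ∣ a - ℓ (toℕ w) ∣) ℓx≡ℓy ⟩
    suc ∣ ℓ (toℕ y) - ℓ (toℕ w) ∣  ≡⟨ cong suc (consecutive⇒∣-∣≡1 (consecutive-sym c)) ⟩
    2                              ≡⟨ sym (layerDist-sameLayer ℓ x≢y ℓx≡ℓy) ⟩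
    D x y ∎)
    where
    ℓx≢ℓw : ℓ (toℕ x) ≢ ℓ (toℕ w)
    ℓx≢ℓw ℓx≡ℓw = consecutive⇒≢ c (trans (sym ℓx≡ℓw) ℓx≡ℓy)

  predecessor-otherLayer : ∀ x y → ℓ (toℕ x) ≢ ℓ (toℕ y) → Predecessor x y
  predecessor-otherLayer x y ℓx≢ℓy with r , c , btw , step ← stepToward ℓx≢ℓy with r ≟ ℓ (toℕ x)
  ... | yes refl = x , consecutive⇒edge x y c , (begin
    suc (D x x)                    ≡⟨ cong suc (layerDist-refl ℓ (toℕ x)) ⟩
    1                              ≡⟨ cong suc (sym (∣n-n∣≡0 (ℓ (toℕ x)))) ⟩
    suc ∣ ℓ (toℕ x) - ℓ (toℕ x) ∣  ≡⟨ step ⟩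
    ∣ ℓ (toℕ x) - ℓ (toℕ y) ∣      ≡⟨ sym (layerDist-otherLayer ℓ ℓx≢ℓy) ⟩
    D x y ∎)
  ... | no r≢ℓx with w , refl ← layerBetween x y r btw = w , consecutive⇒edge w y c , (begin
    suc (D x w)                    ≡⟨ cong suc (layerDist-otherLayer ℓ (r≢ℓx ∘ sym)) ⟩
    suc ∣ ℓ (toℕ x) - ℓ (toℕ w) ∣  ≡⟨ step ⟩
    ∣ ℓ (toℕ x) - ℓ (toℕ y) ∣      ≡⟨ sym (layerDist-otherLayer ℓ ℓx≢ℓy) ⟩
    D x y ∎)

  predecessor : ∀ x y → toℕ x ≢ toℕ y → Predecessor x y
  predecessor x y x≢y = byLayer (ℓ (toℕ x) ≟ ℓ (toℕ y))
    where
    byLayer : Dec (ℓ (toℕ x) ≡ ℓ (toℕ y)) → Predecessor x y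
    byLayer (yes ℓx≡ℓy) = predecessor-sameLayer x y x≢y ℓx≡ℓy
    byLayer (no ℓx≢ℓy)  = predecessor-otherLayer x y ℓx≢ℓy

  within⇒layerDist≤ : ∀ d x y → T (within G d x y) → D x y ≤ d
  within⇒layerDist≤ zero x y x≡y rewrite ≡ᵇ⇒≡ (toℕ x) (toℕ y) x≡y | layerDist-refl ℓ (toℕ y) = z≤n
  within⇒layerDist≤ (suc d) x y h with to T-∨ h
  ... | inj₁ near = m≤n⇒m≤1+n (within⇒layerDist≤ d x y near)
  ... | inj₂ via with w , xw∧wy ← satisfied (Any.any⁻ _ (allFin n) via) with xw , wy ← to T-∧ xw∧wy =
    ≤-trans (layerDist-step x w y (edge⇒consecutive w y wy)) (s≤s (within⇒layerDist≤ d x w xw))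

  layerDist≤⇒within : ∀ d x y → D x y ≤ d → T (within G d x y)
  layerDist≤⇒within zero x y D≤0 = ≡⇒≡ᵇ (toℕ x) (toℕ y) (layerDist≡0⇒≡ ℓ (n≤0⇒n≡0 D≤0))
  layerDist≤⇒within (suc d) x y D≤1+d with D x y ≤? d
  ... | yes D≤d = from T-∨ (inj₁ (layerDist≤⇒within d x y D≤d))
  ... | no D≰d = through (predecessor x y x≢y)
    where
    x≢y : toℕ x ≢ toℕ y
    x≢y x≡y = D≰d (subst (_≤ d) (sym Dxy≡0) z≤n)
      where
      Dxy≡0 : D x y ≡ 0
      Dxy≡0 = trans (cong (layerDist ℓ (toℕ x)) (sym x≡y)) (layerDist-refl ℓ (toℕ x))
    through : Predecessor x y → T (within G (suc d) x y)
    through (w , wy , step) = from T-∨ (inj₂ (Any.any⁺ _ (lose (∈-allFin w) (from T-∧ (xw , wy)))))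
      where
      xw : T (within G d x w)
      xw = layerDist≤⇒within d x w (s≤s⁻¹ (subst (_≤ suc d) (sym step) D≤1+d))

  search≡layerDist : ∀ x y i fuel → i ≤ D x y → D x y ≤ i + fuel → search G x y i fuel ≡ D x y
  search≡layerDist x y i zero    i≤D D≤i+0 = ≤-antisym i≤D (subst (D x y ≤_) (+-identityʳ i) D≤i+0)
  search≡layerDist x y i (suc fuel) i≤D D≤i+1+fuel with within G i x y in reached
  ... | true  = ≤-antisym i≤D (within⇒layerDist≤ i x y (subst T (sym reached) tt))
  ... | false = search≡layerDist x y (suc i) fuel i<D (subst (D x y ≤_) (+-suc i fuel) D≤i+1+fuel)
    where
    i<D : i < D x y
    i<D = ≰⇒> (λ D≤i → subst T reached (layerDist≤⇒within i x y D≤i))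

  dist≡layerDist : (∀ x y → D x y ≤ n) → ∀ x y → dist G x y ≡ D x y
  dist≡layerDist D≤n x y = search≡layerDist x y 0 n z≤n (D≤n x y)

Joins : ℕ × ℕ → ℕ → ℕ → Set
Joins (a , b) X Y = (a ≡ X × b ≡ Y) ⊎ (a ≡ Y × b ≡ X)

joins-sym : ∀ {e X Y} → Joins e X Y → Joins e Y X
joins-sym (inj₁ e) = inj₂ e
joins-sym (inj₂ e) = inj₁ e

joins⇒edgeTest : ∀ {a b X Y} → Joins (a , b) X Y → T (((a ≡ᵇ X) ∧ (b ≡ᵇ Y)) ∨ ((a ≡ᵇ Y) ∧ (b ≡ᵇ X)))
joins⇒edgeTest {a} {b} (inj₁ (refl , refl)) = from T-∨ (inj₁ (from T-∧ (≡⇒≡ᵇ a a refl , ≡⇒≡ᵇ b b refl)))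
joins⇒edgeTest {a} {b} (inj₂ (refl , refl)) = from T-∨ (inj₂ (from T-∧ (≡⇒≡ᵇ a a refl , ≡⇒≡ᵇ b b refl)))

edgeTest⇒joins : ∀ {a b X Y} → T (((a ≡ᵇ X) ∧ (b ≡ᵇ Y)) ∨ ((a ≡ᵇ Y) ∧ (b ≡ᵇ X))) → Joins (a , b) X Y
edgeTest⇒joins {a} {b} {X} {Y} t with to T-∨ t
... | inj₁ t′ with a≡X , b≡Y ← to T-∧ t′ = inj₁ (≡ᵇ⇒≡ a X a≡X , ≡ᵇ⇒≡ b Y b≡Y)
... | inj₂ t′ with a≡Y , b≡X ← to T-∧ t′ = inj₂ (≡ᵇ⇒≡ a Y a≡Y , ≡ᵇ⇒≡ b X b≡X)

EdgeIn : List (ℕ × ℕ) → ℕ → ℕ → Set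
EdgeIn es X Y = Any (λ e → Joins e X Y) es

fromEdges⁺ : ∀ n es (x y : Fin n) → EdgeIn es (toℕ x) (toℕ y) → T (fromEdges n es x y)
fromEdges⁺ n es x y e = Any.any⁺ _ (Any.map (λ { {_ , _} → joins⇒edgeTest }) e)

fromEdges⁻ : ∀ n es (x y : Fin n) → T (fromEdges n es x y) → EdgeIn es (toℕ x) (toℕ y)
fromEdges⁻ n es x y t = Any.map (λ { {_ , _} → edgeTest⇒joins }) (Any.any⁻ _ es t)

tailLayer : ℕ → ℕ → ℕ → ℕ
tailLayer (suc k) l zero    = 0
tailLayer (suc k) l (suc Y) = tailLayer k l Y
tailLayer zero    l Y       = 3 + (Y ⊓ l)

onionLayer : ℕ → ℕ → ℕ → ℕ
onionLayer k l 0                   = 2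
onionLayer k l 1                   = 1
onionLayer k l 2                   = 2
onionLayer k l (suc (suc (suc Y))) = tailLayer k l Y

module _ {k l : ℕ} where

  onionLayer-leafV : ∀ {i} → i < k → onionLayer k l (3 + i) ≡ 0
  onionLayer-leafV = go
    where
    go : ∀ {k i} → i < k → tailLayer k l i ≡ 0
    go {suc k} {zero}  _         = refl
    go {suc k} {suc i} (s≤s i<k) = go i<k

  tailLayer-+ : ∀ k Y → tailLayer k l (k + Y) ≡ 3 + (Y ⊓ l)
  tailLayer-+ zero    Y = refl
  tailLayer-+ (suc k) Y = tailLayer-+ k Y

  onionLayer-path : ∀ {j} → j < l → onionLayer k l (3 + k + j) ≡ 3 + j
  onionLayer-path {j} j<l = trans (tailLayer-+ k j) (cong (3 +_) (m≤n⇒m⊓n≡m (<⇒≤ j<l)))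

  onionLayer-leafP : ∀ q → onionLayer k l (3 + k + l + q) ≡ 3 + l
  onionLayer-leafP q = begin
    tailLayer k l (k + l + q)  ≡⟨ cong (tailLayer k l) (+-assoc k l q) ⟩
    tailLayer k l (k + (l + q)) ≡⟨ tailLayer-+ k (l + q) ⟩
    3 + ((l + q) ⊓ l)          ≡⟨ cong (3 +_) (m≥n⇒m⊓n≡n (m≤m+n l q)) ⟩
    3 + l ∎

  onionLayer≤ : ∀ X → onionLayer k l X ≤ 3 + l
  onionLayer≤ 0                   = s≤s (s≤s z≤n)
  onionLayer≤ 1                   = s≤s z≤n
  onionLayer≤ 2                   = s≤s (s≤s z≤n)
  onionLayer≤ (suc (suc (suc Y))) = go k Y
    where
    go : ∀ k Y → tailLayer k l Y ≤ 3 + l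
    go (suc k) zero    = z≤n
    go (suc k) (suc Y) = go k Y
    go zero    Y       = +-monoʳ-≤ 3 (m⊓n≤n Y l)

  onionLayer-u : onionLayer k l (3 + k) ≡ 3
  onionLayer-u = go k
    where
    go : ∀ k → tailLayer k l k ≡ 3
    go zero    = refl
    go (suc k) = go k

ConsecutiveEdge : ℕ → ℕ → ℕ × ℕ → Set
ConsecutiveEdge k l (a , b) = Consecutive (onionLayer k l a) (onionLayer k l b)

onionEdges-consecutive : ∀ k l m → 1 ≤ l → All (ConsecutiveEdge k l) (onionEdges k l m)
onionEdges-consecutive k (suc l′) m _ =
  ua ∷ inj₂ refl ∷ inj₁ refl ∷ bu ∷ All.++⁺ spokes (All.++⁺ pathEdges leafEdges)
  where
  l : ℕ
  l = suc l′
  ua : ConsecutiveEdge k l (3 + k , 0)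
  ua rewrite onionLayer-u {k} {l} = inj₂ refl
  bu : ConsecutiveEdge k l (2 , 3 + k)
  bu rewrite onionLayer-u {k} {l} = inj₁ refl
  spokes : All (ConsecutiveEdge k l) (map (λ i → (1 , 3 + i)) (upTo k))
  spokes = All.map⁺ (All.map (λ i<k → inj₂ (cong suc (onionLayer-leafV {k} {l} i<k))) (All.all-upTo k))
  pathEdges : All (ConsecutiveEdge k l) (map (λ i → (3 + k + i , 3 + k + suc i)) (upTo l′))
  pathEdges = All.map⁺ (All.map (λ i<l′ → inj₁ (trans (cong suc (onionLayer-path {k} {l} (m<n⇒m<1+n i<l′)))
                                                       (sym (onionLayer-path {k} {l} (s≤s i<l′)))))
                                (All.all-upTo l′))
  leafEdges : All (ConsecutiveEdge k l) (map (λ j → (3 + k + l′ , 3 + k + l + j)) (upTo m))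
  leafEdges = All.map⁺ (All.map (λ {j} _ → inj₁ (trans (cong suc (onionLayer-path {k} {l} ≤-refl))
                                                        (sym (onionLayer-leafP {k} {l} j))))
                                (All.all-upTo m))

data OnionVertex (k l m : ℕ) : ℕ → Set where
  vertex-a : OnionVertex k l m 0
  vertex-v : OnionVertex k l m 1
  vertex-b : OnionVertex k l m 2
  leaf-v   : ∀ i → i < k → OnionVertex k l m (3 + i)
  path     : ∀ j → j < l → OnionVertex k l m (3 + k + j)
  leaf-p   : ∀ q → q < m → OnionVertex k l m (3 + k + l + q)

classify : ∀ k l m X → X < onionSize k l m → OnionVertex k l m X
classify k l m 0 _ = vertex-a
classify k l m 1 _ = vertex-v
classify k l m 2 _ = vertex-b
classify k l m (suc (suc (suc Y))) (s≤s (s≤s (s≤s Y<k+l+m))) with Y <? k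
... | yes i<k = leaf-v Y i<k
... | no Y≮k with j , refl ← m≤n⇒∃[o]m+o≡n (≮⇒≥ Y≮k) with j <? l
...   | yes j<l = path j j<l
...   | no j≮l with q , refl ← m≤n⇒∃[o]m+o≡n (≮⇒≥ j≮l) =
  subst (OnionVertex k l m) (cong (3 +_) (+-assoc k l q)) (leaf-p q q<m)
  where
  q<m : q < m
  q<m = +-cancelˡ-< (k + l) q m (subst (_< k + l + m) (sym (+-assoc k l q)) Y<k+l+m)

module _ {k l m : ℕ} where

  layerOf : ∀ {X} → OnionVertex k l m X → ℕ
  layerOf vertex-a     = 2
  layerOf vertex-v     = 1
  layerOf vertex-b     = 2
  layerOf (leaf-v _ _) = 0
  layerOf (path j _)   = 3 + j
  layerOf (leaf-p _ _) = 3 + l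

  onionLayer-layerOf : ∀ {X} (v : OnionVertex k l m X) → onionLayer k l X ≡ layerOf v
  onionLayer-layerOf vertex-a       = refl
  onionLayer-layerOf vertex-v       = refl
  onionLayer-layerOf vertex-b       = refl
  onionLayer-layerOf (leaf-v i i<k) = onionLayer-leafV {k} {l} i<k
  onionLayer-layerOf (path j j<l)   = onionLayer-path {k} {l} j<l
  onionLayer-layerOf (leaf-p q _)   = onionLayer-leafP {k} {l} q

  layerOf≤ : ∀ {X} (v : OnionVertex k l m X) → layerOf v ≤ 3 + l
  layerOf≤ {X} v = subst (_≤ 3 + l) (onionLayer-layerOf v) (onionLayer≤ {k} {l} X)

  Edge : ℕ → ℕ → Set
  Edge = EdgeIn (onionEdges k l m)

  edge-au : Edge 0 (3 + k + 0)
  edge-au = here (inj₂ (sym (+-identityʳ (3 + k)) , refl))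

  edge-va : Edge 1 0
  edge-va = there (here (inj₂ (refl , refl)))

  edge-vb : Edge 1 2
  edge-vb = there (there (here (inj₁ (refl , refl))))

  edge-bu : Edge 2 (3 + k + 0)
  edge-bu = there (there (there (here (inj₁ (refl , sym (+-identityʳ (3 + k)))))))

  edge-spoke : ∀ {i} → i < k → Edge (3 + i) 1
  edge-spoke i<k = there (there (there (there
    (Any.++⁺ˡ (Any.map⁺ (lose (∈-upTo⁺ i<k) (inj₂ (refl , refl))))))))

  edge-path : ∀ {j} → suc j < l → Edge (3 + k + j) (3 + k + suc j)
  edge-path {j} 1+j<l = there (there (there (there
    (Any.++⁺ʳ (map (λ i → (1 , 3 + i)) (upTo k))
      (Any.++⁺ˡ (Any.map⁺ (lose (∈-upTo⁺ j<l∸1) (inj₁ (refl , refl)))))))))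
    where
    j<l∸1 : j < l ∸ 1
    j<l∸1 = ∸-monoˡ-≤ 1 1+j<l

  edge-leaf : ∀ {j q} → suc j ≡ l → q < m → Edge (3 + k + j) (3 + k + l + q)
  edge-leaf {j} 1+j≡l q<m = there (there (there (there
    (Any.++⁺ʳ (map (λ i → (1 , 3 + i)) (upTo k))
      (Any.++⁺ʳ (map (λ i → (3 + k + i , 3 + k + suc i)) (upTo (l ∸ 1)))
        (Any.map⁺ (lose (∈-upTo⁺ q<m) (inj₁ (cong (λ i → 3 + k + (i ∸ 1)) (sym 1+j≡l) , refl)))))))))

  consecutiveView⇒edge : 1 ≤ l → ∀ {X Y} (x : OnionVertex k l m X) (y : OnionVertex k l m Y) →
    suc (layerOf x) ≡ layerOf y → Edge X Y
  consecutiveView⇒edge _   vertex-a       vertex-a         ()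
  consecutiveView⇒edge _   vertex-a       vertex-v         ()
  consecutiveView⇒edge _   vertex-a       vertex-b         ()
  consecutiveView⇒edge _   vertex-a       (leaf-v _ _)     ()
  consecutiveView⇒edge _   vertex-a       (path 0 _)       refl = edge-au
  consecutiveView⇒edge _   vertex-a       (path (suc _) _) ()
  consecutiveView⇒edge 1≤l vertex-a       (leaf-p _ _)     3≡3+l = contradiction (+-cancelˡ-≡ 3 0 l 3≡3+l) (<⇒≢ 1≤l)
  consecutiveView⇒edge _   vertex-v       vertex-a         refl = edge-va
  consecutiveView⇒edge _   vertex-v       vertex-v         ()
  consecutiveView⇒edge _   vertex-v       vertex-b         refl = edge-vb
  consecutiveView⇒edge _   vertex-v       (leaf-v _ _)     ()
  consecutiveView⇒edge _   vertex-v       (path _ _)       ()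
  consecutiveView⇒edge _   vertex-v       (leaf-p _ _)     ()
  consecutiveView⇒edge _   vertex-b       vertex-a         ()
  consecutiveView⇒edge _   vertex-b       vertex-v         ()
  consecutiveView⇒edge _   vertex-b       vertex-b         ()
  consecutiveView⇒edge _   vertex-b       (leaf-v _ _)     ()
  consecutiveView⇒edge _   vertex-b       (path 0 _)       refl = edge-bu
  consecutiveView⇒edge _   vertex-b       (path (suc _) _) ()
  consecutiveView⇒edge 1≤l vertex-b       (leaf-p _ _)     3≡3+l = contradiction (+-cancelˡ-≡ 3 0 l 3≡3+l) (<⇒≢ 1≤l)
  consecutiveView⇒edge _   (leaf-v _ _)   vertex-a         ()
  consecutiveView⇒edge _   (leaf-v _ i<k) vertex-v         refl = edge-spoke i<k
  consecutiveView⇒edge _   (leaf-v _ _)   vertex-b         ()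
  consecutiveView⇒edge _   (leaf-v _ _)   (leaf-v _ _)     ()
  consecutiveView⇒edge _   (leaf-v _ _)   (path _ _)       ()
  consecutiveView⇒edge _   (leaf-v _ _)   (leaf-p _ _)     ()
  consecutiveView⇒edge _   (path _ _)     vertex-a         ()
  consecutiveView⇒edge _   (path _ _)     vertex-v         ()
  consecutiveView⇒edge _   (path _ _)     vertex-b         ()
  consecutiveView⇒edge _   (path _ _)     (leaf-v _ _)     ()
  consecutiveView⇒edge _   (path _ _)     (path _ j′<l)    refl = edge-path j′<l
  consecutiveView⇒edge _   (path _ _)     (leaf-p _ q<m)   e = edge-leaf (+-cancelˡ-≡ 3 _ _ e) q<m
  consecutiveView⇒edge _   (leaf-p _ _)   y                e = contradiction (subst (_≤ 3 + l) (sym e) (layerOf≤ y)) 1+n≰n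

joins-consecutive : ∀ {k l} e {X Y} → ConsecutiveEdge k l e → Joins e X Y →
  Consecutive (onionLayer k l X) (onionLayer k l Y)
joins-consecutive (a , b) c (inj₁ (refl , refl)) = c
joins-consecutive (a , b) c (inj₂ (refl , refl)) = consecutive-sym c

module _ (k l m : ℕ) (1≤l : 1 ≤ l) where

  private
    N : ℕ
    N = onionSize k l m
    ℓ : ℕ → ℕ
    ℓ = onionLayer k l

  onion-edge⇒consecutive : ∀ (x y : Fin N) → T (On k l m x y) → Consecutive (ℓ (toℕ x)) (ℓ (toℕ y))
  onion-edge⇒consecutive x y xy with e ← fromEdges⁻ N (onionEdges k l m) x y xy
    with c , j ← All.lookupAny (onionEdges-consecutive k l m 1≤l) e = joins-consecutive (Any.lookup e) c j

  onion-consecutive⇒edge : ∀ (x y : Fin N) → Consecutive (ℓ (toℕ x)) (ℓ (toℕ y)) → T (On k l m x y)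
  onion-consecutive⇒edge x y c = fromEdges⁺ N (onionEdges k l m) x y (edge c)
    where
    vx : OnionVertex k l m (toℕ x)
    vx = classify k l m (toℕ x) (toℕ<n x)
    vy : OnionVertex k l m (toℕ y)
    vy = classify k l m (toℕ y) (toℕ<n y)
    viaViews : ∀ {X Y} (u : OnionVertex k l m X) (v : OnionVertex k l m Y) → suc (ℓ X) ≡ ℓ Y → Edge {k} {l} {m} X Y
    viaViews u v e =
      consecutiveView⇒edge 1≤l u v (subst₂ (λ a b → suc a ≡ b) (onionLayer-layerOf u) (onionLayer-layerOf v) e)
    edge : Consecutive (ℓ (toℕ x)) (ℓ (toℕ y)) → Edge {k} {l} {m} (toℕ x) (toℕ y)
    edge (inj₁ e) = viaViews vx vy e
    edge (inj₂ e) = Any.map joins-sym (viaViews vy vx e)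

  onion-convex : ∀ (x y : Fin N) (r : ℕ) → ℓ (toℕ x) ≤ r → r ≤ ℓ (toℕ y) → Σ[ w ∈ Fin N ] ℓ (toℕ w) ≡ r
  onion-convex x y 0 ℓx≤0 _ = x , n≤0⇒n≡0 ℓx≤0
  onion-convex x y 1 _ _    = Fin.suc Fin.zero , refl
  onion-convex x y 2 _ _    = Fin.zero , refl
  onion-convex x y (suc (suc (suc j))) _ r≤ℓy with j <? l
  ... | yes j<l = fromℕ< 3+k+j<N , trans (cong ℓ (toℕ-fromℕ< 3+k+j<N)) (onionLayer-path {k} {l} j<l)
    where
    3+k+j<N : 3 + k + j < N
    3+k+j<N = ≤-trans (+-monoʳ-< (3 + k) j<l) (m≤m+n (3 + k + l) m)
  ... | no j≮l = y , ≤-antisym (≤-trans (onionLayer≤ {k} {l} (toℕ y)) (+-monoʳ-≤ 3 (≮⇒≥ j≮l))) r≤ℓy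

  onion-dist : ∀ x y → dist (On k l m) x y ≡ layerDist ℓ (toℕ x) (toℕ y)
  onion-dist = dist≡layerDist layerDist≤N
    where
    open LayeredGraph (On k l m) ℓ onion-edge⇒consecutive onion-consecutive⇒edge onion-convex
                      Fin.zero (Fin.suc Fin.zero) (λ ())
    layerDist≤N : ∀ x y → D x y ≤ N
    layerDist≤N x y =
      ≤-trans (layerDist≤ ℓ {toℕ x} {toℕ y} (onionLayer≤ {k} (toℕ x)) (onionLayer≤ {k} (toℕ y)) (s≤s (s≤s z≤n)))
              (≤-trans (m≤n+m (3 + l) (k + m)) (≤-reflexive (size k l m)))
      where
      size : ∀ k l m → k + m + (3 + l) ≡ 3 + k + l + m
      size = solve-∀

module OnionRows (k l : ℕ) where

  ℓ : ℕ → ℕ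
  ℓ = onionLayer k l

  D : ℕ → ℕ → ℕ
  D = layerDist ℓ

  row : ℕ → ℕ
  row Y = sumBelow Y (λ X → D X Y)

  D-layers : ∀ X Y {a b} → ℓ X ≡ a → ℓ Y ≡ b → a ≢ b → D X Y ≡ ∣ a - b ∣
  D-layers X Y refl refl a≢b = layerDist-otherLayer ℓ {X} {Y} a≢b

  sumBelow-sameLayer : ∀ o c → (∀ t → t < c → ℓ (o + t) ≡ ℓ (o + c)) →
    sumBelow c (λ t → D (o + t) (o + c)) ≡ c * 2
  sumBelow-sameLayer o c same = trans
    (sumBelow-cong c (λ t t<c → layerDist-sameLayer ℓ {o + t} {o + c} (<⇒≢ (+-monoʳ-< o t<c)) (same t t<c)))
    (sumBelow-const c 2)

  cycle-row : ∀ Y {h} → ℓ Y ≡ h → 1 ≢ h → 2 ≢ h → ∀ r →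
    D 0 Y + (D 1 Y + (D 2 Y + r)) ≡ ∣ 2 - h ∣ + (∣ 1 - h ∣ + (∣ 2 - h ∣ + r))
  cycle-row Y ℓY 1≢h 2≢h r =
    cong₂ _+_ (D-layers 0 Y refl ℓY 2≢h) (cong₂ _+_ (D-layers 1 Y refl ℓY 1≢h) (cong (_+ r) (D-layers 2 Y refl ℓY 2≢h)))

  head-row : ∀ Y j → ℓ Y ≡ 3 + j → sumBelow (3 + k) (λ X → D X Y) ≡ 4 + 3 * j + k * (3 + j)
  head-row Y j ℓY = begin
    D 0 Y + (D 1 Y + (D 2 Y + sumBelow k (λ i → D (3 + i) Y)))
      ≡⟨ cycle-row Y ℓY (λ ()) (λ ()) _ ⟩
    suc j + (2 + j + (suc j + sumBelow k (λ i → D (3 + i) Y)))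
      ≡⟨ cong (λ s → suc j + (2 + j + (suc j + s))) leaves ⟩
    suc j + (2 + j + (suc j + k * (3 + j)))
      ≡⟨ regroup j k ⟩
    4 + 3 * j + k * (3 + j) ∎
    where
    leaves : sumBelow k (λ i → D (3 + i) Y) ≡ k * (3 + j)
    leaves = trans (sumBelow-cong k (λ i i<k → D-layers (3 + i) Y (onionLayer-leafV {k} {l} i<k) ℓY (λ ())))
                   (sumBelow-const k (3 + j))
    regroup : ∀ j k → suc j + (2 + j + (suc j + k * (3 + j))) ≡ 4 + 3 * j + k * (3 + j)
    regroup = solve-∀

  path-row : ∀ Y j → ℓ Y ≡ 3 + j → j ≤ l → sumBelow j (λ t → D (3 + k + t) Y) ≡ triangular j + j
  path-row Y j ℓY j≤l = trans
    (sumBelow-cong j (λ t t<j →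
      trans (D-layers (3 + k + t) Y (onionLayer-path {k} {l} (<-≤-trans t<j j≤l)) ℓY (<⇒≢ (+-monoʳ-< 3 t<j)))
            (m≤n⇒∣m-n∣≡n∸m (<⇒≤ t<j))))
    (sumBelow-∸ j)

  row-leafV : ∀ i → i < k → row (3 + i) ≡ 5 + 2 * i
  row-leafV i i<k = begin
    D 0 Y + (D 1 Y + (D 2 Y + sumBelow i (λ t → D (3 + t) Y)))
      ≡⟨ cycle-row Y ℓY (λ ()) (λ ()) _ ⟩
    2 + (1 + (2 + sumBelow i (λ t → D (3 + t) Y)))
      ≡⟨ cong (λ s → 2 + (1 + (2 + s))) (sumBelow-sameLayer 3 i earlierLeaves) ⟩
    2 + (1 + (2 + i * 2))
      ≡⟨ regroup i ⟩
    5 + 2 * i ∎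
    where
    Y : ℕ
    Y = 3 + i
    ℓY : ℓ Y ≡ 0
    ℓY = onionLayer-leafV {k} {l} i<k
    earlierLeaves : ∀ t → t < i → ℓ (3 + t) ≡ ℓ Y
    earlierLeaves t t<i = trans (onionLayer-leafV {k} {l} (<-trans t<i i<k)) (sym ℓY)
    regroup : ∀ i → 2 + (1 + (2 + i * 2)) ≡ 5 + 2 * i
    regroup = solve-∀

  row-path : ∀ j → j < l → row (3 + k + j) ≡ (4 + 3 * k) + (4 + k) * j + triangular j
  row-path j j<l = begin
    row Y
      ≡⟨ sumBelow-+ (3 + k) j (λ X → D X Y) ⟩
    sumBelow (3 + k) (λ X → D X Y) + sumBelow j (λ t → D (3 + k + t) Y)
      ≡⟨ cong₂ _+_ (head-row Y j ℓY) (path-row Y j ℓY (<⇒≤ j<l)) ⟩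
    4 + 3 * j + k * (3 + j) + (triangular j + j)
      ≡⟨ regroup j k (triangular j) ⟩
    (4 + 3 * k) + (4 + k) * j + triangular j ∎
    where
    Y : ℕ
    Y = 3 + k + j
    ℓY : ℓ Y ≡ 3 + j
    ℓY = onionLayer-path {k} {l} j<l
    regroup : ∀ j k t → 4 + 3 * j + k * (3 + j) + (t + j) ≡ (4 + 3 * k) + (4 + k) * j + t
    regroup = solve-∀

  leafP-base : ℕ
  leafP-base = 4 + 3 * l + k * (3 + l) + (triangular l + l)

  row-leafP : ∀ q → row (3 + k + l + q) ≡ leafP-base + 2 * q
  row-leafP q = begin
    row Y
      ≡⟨ sumBelow-+ (3 + k + l) q (λ X → D X Y) ⟩
    sumBelow (3 + k + l) (λ X → D X Y) + sumBelow q (λ t → D (3 + k + l + t) Y)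
      ≡⟨ cong (_+ sumBelow q (λ t → D (3 + k + l + t) Y)) (sumBelow-+ (3 + k) l (λ X → D X Y)) ⟩
    sumBelow (3 + k) (λ X → D X Y) + sumBelow l (λ t → D (3 + k + t) Y) + sumBelow q (λ t → D (3 + k + l + t) Y)
      ≡⟨ cong₂ _+_ (cong₂ _+_ (head-row Y l ℓY) (path-row Y l ℓY ≤-refl))
                   (sumBelow-sameLayer (3 + k + l) q (λ t _ → trans (onionLayer-leafP {k} {l} t) (sym ℓY))) ⟩
    leafP-base + q * 2
      ≡⟨ cong (leafP-base +_) (*-comm q 2) ⟩
    leafP-base + 2 * q ∎
    where
    Y : ℕ
    Y = 3 + k + l + q
    ℓY : ℓ Y ≡ 3 + l
    ℓY = onionLayer-leafP {k} {l} q

  sumBelow-rows : ∀ m → sumBelow (onionSize k l m) row ≡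
    4 + (k * 5 + 2 * triangular k) + (l * (4 + 3 * k) + (4 + k) * triangular l + tetrahedral l)
      + (m * leafP-base + 2 * triangular m)
  sumBelow-rows m = begin
    sumBelow (3 + k + l + m) row
      ≡⟨ sumBelow-+ (3 + k + l) m row ⟩
    sumBelow (3 + k + l) row + sumBelow m (λ q → row (3 + k + l + q))
      ≡⟨ cong (_+ sumBelow m (λ q → row (3 + k + l + q))) (sumBelow-+ (3 + k) l row) ⟩
    4 + sumBelow k (λ i → row (3 + i)) + sumBelow l (λ j → row (3 + k + j)) + sumBelow m (λ q → row (3 + k + l + q))
      ≡⟨ cong₂ _+_ (cong₂ _+_ (cong (4 +_) (trans (sumBelow-cong k row-leafV) (sumBelow-linear k 5 2)))
                              (trans (sumBelow-cong l row-path) (sumBelow-linear+triangular l (4 + 3 * k) (4 + k))))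
                   (trans (sumBelow-cong m (λ q _ → row-leafP q)) (sumBelow-linear m leafP-base 2)) ⟩
    4 + (k * 5 + 2 * triangular k) + (l * (4 + 3 * k) + (4 + k) * triangular l + tetrahedral l)
      + (m * leafP-base + 2 * triangular m) ∎

lemma10 : (k l m : ℕ) → 1 ≤ l →
    wiener (On k l m) ≡
      k ^ 2 + 7 * k + 8 + (l ^ 3 ∸ l) / 6 + m ^ 2 + m * ((l ^ 2 + l ∸ 2) / 2)
        + (k + 3) * ((l ^ 2 ∸ l) / 2 + m * l) + (l + m ∸ 1) * (3 * k + 4)
lemma10 k l@(suc L) m 1≤l
  rewrite cube-quotient l | square+-quotient L | square-quotient l
        | square≡triangular k | square≡triangular m = begin
  wiener (On k l m)
    ≡⟨ wiener≡sumBelow (On k l m) D (onion-dist k l m 1≤l) ⟩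
  sumBelow (onionSize k l m) row
    ≡⟨ sumBelow-rows m ⟩
  _ ≡⟨ closed-form k L m (triangular k) (triangular m) (triangular l) (tetrahedral l) ⟩
  _ ∎
  where
  open OnionRows k l
  closed-form : ∀ k L m tk tm tl Tl →
    4 + (k * 5 + 2 * tk) + (suc L * (4 + 3 * k) + (4 + k) * tl + Tl)
      + (m * (4 + 3 * suc L + k * (3 + suc L) + (tl + suc L)) + 2 * tm)
    ≡ tk * 2 + k + 7 * k + 8 + (Tl + tl) + (tm * 2 + m) + m * (tl + L)
      + (k + 3) * (tl + m * suc L) + (L + m) * (3 * k + 4)
  closed-form = solve-∀
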